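{- Let $r\geq 1$ and let $\mathcal{F}_r$ be the set of overpartitions in which the first occurrence of a number may be overlined and there are no $r$ consecutive parts which are all non-overlined. Then $\mathcal{F}_r$ is a separable overpartition class.
   Context: An overpartition (in the "first occurrence" convention) is a partition in which the first occurrence of a number may be overlined; parts are listed in non-increasing order of size, with $\overline{t}$ listed before the non-overlined copies of $t$. Consecutiveness refers to positions in this list. For a positive integer $t$ and nonnegative integer $d$, $\overline{t}+d=\overline{t+d}$. A separable overpartition class is a set $\mathcal{P}$ of overpartitions for which there is a subset $\mathcal{B}\subset\mathcal{P}$ (the basis) such that for each $m\geq 1$ the number of overpartitions in $\mathcal{B}$ with $m$ parts is finite, every overpartition in $\mathcal{P}$ with $m$ parts is uniquely of the form $(b_1+\pi_1,\ldots,b_m+\pi_m)$ with $(b_1,\ldots,b_m)\in\mathcal{B}$ and $(\pi_1,\ldots,\pi_m)$ a non-increasing sequence of nonnegative integers, and all overpartitions of this form lie in $\mathcal{P}$. -}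

module Defs where

open import Data.Nat using (ℕ; _+_; _≤_; _<_; _≥_)
open import Data.Bool using (Bool; true; false)
open import Data.Product using (Σ; _×_; _,_; proj₁; proj₂)
open import Data.List using (List; []; _∷_; length; zipWith; _++_)
open import Data.List.Relation.Unary.All using (All)
open import Data.List.Relation.Unary.Linked using (Linked)
open import Data.List.Membership.Propositional using (_∈_)
open import Relation.Binary.PropositionalEquality using (_≡_)
open import Relation.Nullary using (¬_)
open import Function.Bundles using (_⇔_)

-- A part of an overpartition: its size and whether it is overlined (true).
Part : Set
Part = ℕ × Bool

size : Part → ℕ
size = proj₁

-- Relation between a part and the NEXT part in the list:
-- the next part is overlined  ⇒ it is strictly smaller (overlined t comes
--   first among the copies of t, and only the first occurrence may be overlined);
-- the next part is not overlined ⇒ it is at most as large.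
Follows : Part → Part → Set
Follows (a , _) (b , true)  = b < a
Follows (a , _) (b , false) = b ≤ a

-- An overpartition, written as its list of parts (b₁, …, bₘ) in the
-- canonical order described in the paper (non-increasing, overlined copy first).
IsOverpartition : List Part → Set
IsOverpartition p = All (λ q → 1 ≤ size q) p × Linked Follows p

NonOverlined : Part → Set
NonOverlined (_ , o) = o ≡ false

addPart : Part → ℕ → Part
addPart (t , o) d = (t + d , o)

addSeq : List Part → List ℕ → List Part
addSeq = zipWith addPart

NonIncreasing : List ℕ → Set
NonIncreasing = Linked _≥_

record IsSeparable (P : List Part → Set) : Set₁ where
  field
    B       : List Part → Set
    B⊆P     : ∀ b → B b → P b
    finite  : ∀ (m : ℕ) → Σ (List (List Part)) λ L →
                ∀ b → (B b × length b ≡ m) ⇔ (b ∈ L)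
    exists  : ∀ p → IsOverpartition p → P p →
                Σ (List Part) λ b → Σ (List ℕ) λ π →
                  B b × length π ≡ length b × NonIncreasing π × p ≡ addSeq b π
    unique  : ∀ p b b′ π π′ → IsOverpartition p → P p →
                B b  → length π  ≡ length b  → NonIncreasing π  → p ≡ addSeq b π →
                B b′ → length π′ ≡ length b′ → NonIncreasing π′ → p ≡ addSeq b′ π′ →
                (b ≡ b′) × (π ≡ π′)
    closed  : ∀ b π → B b → length π ≡ length b → NonIncreasing π →
                IsOverpartition (addSeq b π) → P (addSeq b π)

F : ℕ → List Part → Set
F r p = IsOverpartition p ×
        (∀ xs ys zs → p ≡ xs ++ ys ++ zs → length ys ≡ r → ¬ All NonOverlined ys)

{-# OPTIONS --safe #-}
-- Only the flags of an overpartition matter for membership in F_r.  For a flag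
-- word o₁ … oₘ the smallest overpartition with these flags has i-th part
-- 1 + #{j > i | oⱼ overlined}, and an arbitrary overpartition with the same flags
-- exceeds it by a non-increasing sequence: between consecutive parts the minimum
-- drops by exactly 1 where the actual part drops strictly (next part overlined)
-- and by 0 where it may stay equal.  So the basis consists of these minimal
-- overpartitions whose flag words have no run of r non-overlined letters; the
-- same holds for any class cut out by a decidable condition on flag words.
module Submission where

open import Defs
open import Data.Nat using (ℕ; zero; suc; _≤_; _∸_; s≤s; z≤n)
open import Data.Nat.Properties using (≤-refl; ≤-trans; n<1+n; m+[n∸m]≡n; ∸-monoˡ-≤; +-cancelˡ-≡; suc-injective)
open import Data.Bool using (Bool; true; false)
open import Data.Bool.Properties using () renaming (_≟_ to _≟ᵇ_)
open import Data.Product using (_×_; _,_; proj₁; proj₂)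
open import Data.List using (List; []; _∷_; [_]; length; map; filter; replicate; _++_)
open import Data.List.Properties using (∷-injective; length-map)
open import Data.List.Relation.Unary.All using (All; []; _∷_)
import Data.List.Relation.Unary.All as All
open import Data.List.Relation.Unary.Linked using (Linked; []; [-]; _∷_)
import Data.List.Relation.Unary.Linked as Linked
open import Data.List.Relation.Binary.Pointwise using (Pointwise; []; _∷_; ≡⇒Pointwise-≡)
import Data.List.Relation.Binary.Pointwise as Pointwise
open import Data.List.Relation.Binary.Infix.Heterogeneous using (Infix; MkView; toView; _++ⁱ_; _ⁱ++_)
open import Data.List.Relation.Binary.Infix.Heterogeneous.Properties using (fromPointwise; infix?)
import Data.List.Relation.Binary.Infix.Heterogeneous.Properties as Infix
open import Data.List.Membership.Propositional using (_∈_)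
open import Data.List.Membership.Propositional.Properties using (∈-map⁺; ∈-map⁻; ∈-filter⁺; ∈-filter⁻; ∈-++⁺ˡ; ∈-++⁺ʳ; ∈-++⁻)
open import Data.List.Relation.Unary.Any using (here)
open import Data.Sum using (inj₁; inj₂)
open import Relation.Binary.PropositionalEquality using (_≡_; refl; sym; trans; cong; cong₂; subst)
open import Relation.Nullary using (¬_; ¬?)
import Relation.Nullary.Decidable as Dec
open import Relation.Unary using (Decidable)
open import Function.Base using (_∘_)
open import Function.Bundles using (_⇔_; mk⇔; Equivalence)
import Function.Properties.Equivalence as ⇔

flags : List Part → List Bool
flags = map proj₂

#overlined : List Bool → ℕ
#overlined []           = 0
#overlined (true ∷ os)  = suc (#overlined os)
#overlined (false ∷ os) = #overlined os

minimal : List Bool → List Part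
minimal []       = []
minimal (o ∷ os) = (suc (#overlined os) , o) ∷ minimal os

flags-minimal : ∀ os → flags (minimal os) ≡ os
flags-minimal []       = refl
flags-minimal (o ∷ os) = cong (o ∷_) (flags-minimal os)

length-minimal : ∀ os → length (minimal os) ≡ length os
length-minimal []       = refl
length-minimal (o ∷ os) = cong suc (length-minimal os)

minimal-isOverpartition : ∀ os → IsOverpartition (minimal os)
minimal-isOverpartition os = positive os , linked os
  where
  positive : ∀ os → All (λ q → 1 ≤ size q) (minimal os)
  positive []       = []
  positive (_ ∷ os) = s≤s z≤n ∷ positive os

  linked : ∀ os → Linked Follows (minimal os)
  linked []               = []
  linked (_ ∷ [])         = [-]
  linked (_ ∷ true ∷ os)  = n<1+n _ ∷ linked (true ∷ os)
  linked (_ ∷ false ∷ os) = ≤-refl ∷ linked (false ∷ os)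

minimal≤head : ∀ {x p} → IsOverpartition (x ∷ p) → suc (#overlined (flags p)) ≤ size x
minimal≤head {p = []}              (x≥1 ∷ _ , _)           = x≥1
minimal≤head {p = (_ , true) ∷ p}  (_ ∷ pos , y<x ∷ linked) = ≤-trans (s≤s (minimal≤head (pos , linked))) y<x
minimal≤head {p = (_ , false) ∷ p} (_ ∷ pos , y≤x ∷ linked) = ≤-trans (minimal≤head (pos , linked)) y≤x

excess : List Part → List ℕ
excess []            = []
excess ((t , _) ∷ p) = t ∸ suc (#overlined (flags p)) ∷ excess p

length-excess : ∀ p → length (excess p) ≡ length (minimal (flags p))
length-excess []      = refl
length-excess (_ ∷ p) = cong suc (length-excess p)

excess-nonIncreasing : ∀ {p} → Linked Follows p → NonIncreasing (excess p)
excess-nonIncreasing []  = []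
excess-nonIncreasing [-] = [-]
excess-nonIncreasing {_ ∷ (_ , true) ∷ p}  (y<x ∷ linked) =
  ∸-monoˡ-≤ (suc (suc (#overlined (flags p)))) y<x ∷ excess-nonIncreasing linked
excess-nonIncreasing {_ ∷ (_ , false) ∷ p} (y≤x ∷ linked) =
  ∸-monoˡ-≤ (suc (#overlined (flags p))) y≤x ∷ excess-nonIncreasing linked

minimal+excess : ∀ p → IsOverpartition p → p ≡ addSeq (minimal (flags p)) (excess p)
minimal+excess []            _ = refl
minimal+excess ((t , o) ∷ p) op@(pos , linked) =
  cong₂ _∷_ (cong (_, o) (sym (m+[n∸m]≡n (minimal≤head op))))
            (minimal+excess p (All.tail pos , Linked.tail linked))

flags-addSeq : ∀ b π → length π ≡ length b → flags (addSeq b π) ≡ flags b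
flags-addSeq []            []      _   = refl
flags-addSeq ((_ , o) ∷ b) (_ ∷ π) len = cong (o ∷_) (flags-addSeq b π (suc-injective len))

addSeq-injectiveʳ : ∀ b {π π′} → length π ≡ length b → length π′ ≡ length b →
                    addSeq b π ≡ addSeq b π′ → π ≡ π′
addSeq-injectiveʳ []            {[]}    {[]}      _   _    _  = refl
addSeq-injectiveʳ ((t , _) ∷ b) {_ ∷ _} {_ ∷ _} len len′ eq
  with head-eq , tail-eq ← ∷-injective eq =
  cong₂ _∷_ (+-cancelˡ-≡ t _ _ (cong proj₁ head-eq))
            (addSeq-injectiveʳ b (suc-injective len) (suc-injective len′) tail-eq)

wordsOfLength : ℕ → List (List Bool)
wordsOfLength zero    = [ [] ]
wordsOfLength (suc m) = map (true ∷_) (wordsOfLength m) ++ map (false ∷_) (wordsOfLength m)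

∈-wordsOfLength⁻ : ∀ m {os} → os ∈ wordsOfLength m → length os ≡ m
∈-wordsOfLength⁻ zero    (here refl) = refl
∈-wordsOfLength⁻ (suc m) os∈ with ∈-++⁻ (map (true ∷_) (wordsOfLength m)) os∈
... | inj₁ os∈ with _ , os′∈ , refl ← ∈-map⁻ (true ∷_) os∈  = cong suc (∈-wordsOfLength⁻ m os′∈)
... | inj₂ os∈ with _ , os′∈ , refl ← ∈-map⁻ (false ∷_) os∈ = cong suc (∈-wordsOfLength⁻ m os′∈)

∈-wordsOfLength⁺ : ∀ os → os ∈ wordsOfLength (length os)
∈-wordsOfLength⁺ []           = here refl
∈-wordsOfLength⁺ (true ∷ os)  = ∈-++⁺ˡ (∈-map⁺ (true ∷_) (∈-wordsOfLength⁺ os))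
∈-wordsOfLength⁺ (false ∷ os) = ∈-++⁺ʳ _ (∈-map⁺ (false ∷_) (∈-wordsOfLength⁺ os))

∈-minimals⇔ : ∀ m b → b ∈ map minimal (wordsOfLength m) ⇔ (b ≡ minimal (flags b) × length b ≡ m)
∈-minimals⇔ m b = mk⇔ to from
  where
  to : b ∈ map minimal (wordsOfLength m) → b ≡ minimal (flags b) × length b ≡ m
  to b∈ with os , os∈ , refl ← ∈-map⁻ minimal b∈ =
    cong minimal (sym (flags-minimal os)) ,
    trans (length-minimal os) (∈-wordsOfLength⁻ m os∈)

  from : b ≡ minimal (flags b) × length b ≡ m → b ∈ map minimal (wordsOfLength m)
  from (b≡ , refl) = subst (_∈ map minimal (wordsOfLength (length b))) (sym b≡) (∈-map⁺ minimal flags∈)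
    where
    flags∈ : flags b ∈ wordsOfLength (length b)
    flags∈ = subst (λ k → flags b ∈ wordsOfLength k) (length-map proj₂ b) (∈-wordsOfLength⁺ (flags b))

module _ (Q : List Part → Set) (Q? : Decidable Q)
         (Q-flags : ∀ {p q} → flags p ≡ flags q → Q p → Q q) where

  Basis : List Part → Set
  Basis b = b ≡ minimal (flags b) × Q b

  minimal-basis : ∀ {p} → Q p → Basis (minimal (flags p))
  minimal-basis {p} q = cong minimal (sym flags≡) , Q-flags (sym flags≡) q
    where
    flags≡ : flags (minimal (flags p)) ≡ flags p
    flags≡ = flags-minimal (flags p)

  basis-determined : ∀ {p b π} → Basis b → length π ≡ length b → p ≡ addSeq b π →
                     b ≡ minimal (flags p)
  basis-determined {b = b} {π} (b≡ , _) len refl =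
    trans b≡ (cong minimal (sym (flags-addSeq b π len)))

  flagInvariant-separable : IsSeparable (λ p → IsOverpartition p × Q p)
  flagInvariant-separable = record
    { B      = Basis
    ; B⊆P    = λ b (b≡ , q) → subst IsOverpartition (sym b≡) (minimal-isOverpartition (flags b)) , q
    ; finite = λ m → filter Q? (map minimal (wordsOfLength m)) , ∈-basis⇔ m
    ; exists = λ p op (_ , q) → minimal (flags p) , excess p , minimal-basis q ,
                 length-excess p , excess-nonIncreasing (proj₂ op) , minimal+excess p op
    ; unique = unique
    ; closed = λ b π (_ , q) len _ op → op , Q-flags (sym (flags-addSeq b π len)) q
    }
    where
    ∈-basis⇔ : ∀ m b → (Basis b × length b ≡ m) ⇔ (b ∈ filter Q? (map minimal (wordsOfLength m)))
    ∈-basis⇔ m b = mk⇔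
      (λ ((b≡ , q) , len) → ∈-filter⁺ Q? (Equivalence.from (∈-minimals⇔ m b) (b≡ , len)) q)
      (λ b∈ → let b∈ , q = ∈-filter⁻ Q? b∈
                  b≡ , len = Equivalence.to (∈-minimals⇔ m b) b∈
              in (b≡ , q) , len)

    unique : ∀ p b b′ π π′ → IsOverpartition p → IsOverpartition p × Q p →
             Basis b  → length π  ≡ length b  → NonIncreasing π  → p ≡ addSeq b π →
             Basis b′ → length π′ ≡ length b′ → NonIncreasing π′ → p ≡ addSeq b′ π′ →
             (b ≡ b′) × (π ≡ π′)
    unique p b b′ π π′ _ _ B len _ p≡ B′ len′ _ p≡′
      with refl ← trans (basis-determined B len p≡) (sym (basis-determined B′ len′ p≡′))
      = refl , addSeq-injectiveʳ b len len′ (trans (sym p≡) p≡′)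

HasFlag : Bool → Part → Set
HasFlag o (_ , o′) = o′ ≡ o

HasRun : ℕ → List Part → Set
HasRun r = Infix HasFlag (replicate r false)

hasRun? : ∀ r → Decidable (HasRun r)
hasRun? r = infix? (λ o q → proj₂ q ≟ᵇ o) (replicate r false)

hasRun-flags : ∀ r {p q} → flags p ≡ flags q → HasRun r p → HasRun r q
-- flag-trans is eta-expanded because HasFlag o x reduces to proj₂ x ≡ o, from which
-- unification cannot recover x.
hasRun-flags r {p} {q} flags≡ run =
  Infix.trans (λ {o x y} → flag-trans {o} {x} {y}) run (fromPointwise sameFlags)
  where
  SameFlag : Part → Part → Set
  SameFlag x y = proj₂ x ≡ proj₂ y

  sameFlags : Pointwise SameFlag p q
  sameFlags = Pointwise.map⁻ proj₂ proj₂ (≡⇒Pointwise-≡ flags≡)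

  flag-trans : ∀ {o x y} → HasFlag o x → SameFlag x y → HasFlag o y
  flag-trans x≡o x≡y = trans (sym x≡y) x≡o

RunFree : ℕ → List Part → Set
RunFree r p = ∀ xs ys zs → p ≡ xs ++ ys ++ zs → length ys ≡ r → ¬ All NonOverlined ys

run⇒pointwise : ∀ {ys} → All NonOverlined ys → Pointwise HasFlag (replicate (length ys) false) ys
run⇒pointwise []         = []
run⇒pointwise (no ∷ nos) = no ∷ run⇒pointwise nos

pointwise⇒run : ∀ r {ys} → Pointwise HasFlag (replicate r false) ys → length ys ≡ r × All NonOverlined ys
pointwise⇒run zero    []         = refl , []
pointwise⇒run (suc r) (no ∷ nos) with len , all ← pointwise⇒run r nos = cong suc len , no ∷ all

runFree⇔¬hasRun : ∀ r p → RunFree r p ⇔ (¬ HasRun r p)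
runFree⇔¬hasRun r p = mk⇔ to from
  where
  to : RunFree r p → ¬ HasRun r p
  to free run with MkView xs pw zs ← toView run with len , all ← pointwise⇒run r pw =
    free xs _ zs refl len all

  from : ¬ HasRun r p → RunFree r p
  from noRun xs ys zs refl refl all = noRun (xs ++ⁱ (fromPointwise (run⇒pointwise all) ⁱ++ zs))

runFree? : ∀ r → Decidable (RunFree r)
runFree? r p = Dec.map (⇔.sym (runFree⇔¬hasRun r p)) (¬? (hasRun? r p))

runFree-flags : ∀ r {p q} → flags p ≡ flags q → RunFree r p → RunFree r q
runFree-flags r {p} {q} flags≡ free = Equivalence.from (runFree⇔¬hasRun r q)
  (Equivalence.to (runFree⇔¬hasRun r p) free ∘ hasRun-flags r (sym flags≡))

theorem5p2 : (r : ℕ) → 1 ≤ r → IsSeparable (F r)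
theorem5p2 r _ = flagInvariant-separable (RunFree r) (runFree? r) (runFree-flags r)
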